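{- Let $(P,\leq,{}',0,1)$ be a pseudo-orthomodular poset and define $M(x,y):=L(U(x,y'),y)$ and $R(x,y):=L(U(L(x,y),x'))$ for all $x,y\in P$. Then $\mathbf P=(P,\leq,{}',M,R,0,1)$ is an operator left residuated poset. Moreover, $\mathbf P$ satisfies divisibility (i.e. $M(R(x,y),x)=L(x,y)$ for all $x,y\in P$) if and only if for all $x,y\in P$ \[\bigcup_{z\in R(x,y)}L(U(z,x'),x)=L(U(R(x,y),x'),x).\]
   Context: For a poset $(P,\leq)$ and $A\subseteq P$ let $L(A)=\{x\in P\mid x\leq y\text{ for all }y\in A\}$ and $U(A)=\{x\in P\mid y\leq x\text{ for all }y\in A\}$; we write $L(a)$ for $L(\{a\})$, $L(a,b)$ for $L(\{a,b\})$, $L(A,a)$ for $L(A\cup\{a\})$, $L(A,B)$ for $L(A\cup B)$, etc., and similarly for $U$. A poset with complementation is $(P,\leq,{}',0,1)$ with $(P,\leq,0,1)$ a bounded poset and $'$ a unary operation such that $L(x,x')=\{0\}$, $U(x,x')=\{1\}$, $x\leq y$ implies $y'\leq x'$, and $(x')'=x$. A pseudo-orthomodular poset is a poset with complementation satisfying $L(U(L(x,y),y'),y)=L(x,y)$ for all $x,y$ (equivalently $U(L(U(x,y),y'),y)=U(x,y)$). An operator left residuated poset is a system $(P,\leq,{}',M,R,0,1)$ where $(P,\leq,0,1)$ is a bounded poset, $'$ is a unary operation, and $M,R:P^2\to 2^P$ satisfy for all $x,y,z$: (1) $M(x,1)=M(1,x)=L(x)$; (2) $R(x,y)=P$ iff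 $x\leq y$; (3) $M(x,y)\subseteq L(z)$ iff $L(x)\subseteq R(y,z)$; (4) $R(x,0)=L(x')$. For $A,B\subseteq P$, $M(A,B):=\bigcup_{(x,y)\in A\times B}M(x,y)$ and $R(A,B):=\bigcup_{(x,y)\in A\times B}R(x,y)$ (elements identified with singletons); divisibility is the identity $M(R(x,y),x)=L(x,y)$. -}

module Defs where

open import Level using (Level; suc; Lift)
open import Data.Product using (_×_; Σ-syntax; ∃-syntax; _,_)
open import Data.Sum using (_⊎_)
open import Relation.Binary.PropositionalEquality using (_≡_)
open import Relation.Binary.Structures using (IsPartialOrder)
open import Relation.Unary using (Pred; _⊆_; _∪_)
open import Data.Unit using (⊤)
open import Function.Bundles using (_⇔_)

_≐_ : ∀ {a} {C : Set a} → Pred C a → Pred C a → Set a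
A ≐ B = (A ⊆ B) × (B ⊆ A)

module PosetOps {a} {C : Set a} (_≤_ : C → C → Set a) where
  Lo : Pred C a → Pred C a
  Lo A x = ∀ y → A y → x ≤ y

  Up : Pred C a → Pred C a
  Up A x = ∀ y → A y → y ≤ x

  sg : C → Pred C a
  sg x z = z ≡ x

  pr : C → C → Pred C a
  pr x y z = (z ≡ x) ⊎ (z ≡ y)

  ⋃ : Pred C a → (C → Pred C a) → Pred C a
  ⋃ A F w = ∃[ z ] (A z × F z w)

record BoundedPosetWithOp a : Set (suc a) where
  field
    Carrier : Set a
    _≤_ : Carrier → Carrier → Set a
    isPartialOrder : IsPartialOrder _≡_ _≤_
    𝟘 𝟙 : Carrier
    𝟘-least : ∀ x → 𝟘 ≤ x
    𝟙-greatest : ∀ x → x ≤ 𝟙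
    _′ : Carrier → Carrier
  open PosetOps _≤_ public

module _ {a} (P : BoundedPosetWithOp a) where
  open BoundedPosetWithOp P

  IsComplementation : Set a
  IsComplementation =
      (∀ x → Lo (pr x (x ′)) ≐ sg 𝟘)
    × (∀ x → Up (pr x (x ′)) ≐ sg 𝟙)
    × (∀ x y → x ≤ y → (y ′) ≤ (x ′))
    × (∀ x → ((x ′) ′) ≡ x)

  IsPseudoOrthomodular : Set a
  IsPseudoOrthomodular =
    IsComplementation
    × (∀ x y → Lo (Up (Lo (pr x y) ∪ sg (y ′)) ∪ sg y) ≐ Lo (pr x y))

  Full : Pred Carrier a
  Full _ = Lift a ⊤

  liftM : (Carrier → Carrier → Pred Carrier a) → Pred Carrier a → Pred Carrier a → Pred Carrier a
  liftM M A B w = ∃[ x ] ∃[ y ] (A x × B y × M x y w)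

  IsOperatorLeftResiduated : (M R : Carrier → Carrier → Pred Carrier a) → Set a
  IsOperatorLeftResiduated M R =
      (∀ x → (M x 𝟙 ≐ Lo (sg x)) × (M 𝟙 x ≐ Lo (sg x)))
    × (∀ x y → (R x y ≐ Full) ⇔ (x ≤ y))
    × (∀ x y z → (M x y ⊆ Lo (sg z)) ⇔ (Lo (sg x) ⊆ R y z))
    × (∀ x → R x 𝟘 ≐ Lo (sg (x ′)))

  Divisible : (M R : Carrier → Carrier → Pred Carrier a) → Set a
  Divisible M R = ∀ x y → liftM M (R x y) (sg x) ≐ Lo (pr x y)

  M₅ : Carrier → Carrier → Pred Carrier a
  M₅ x y = Lo (Up (pr x (y ′)) ∪ sg y)

  R₅ : Carrier → Carrier → Pred Carrier a
  R₅ x y = Lo (Up (Lo (pr x y) ∪ sg (x ′)))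

-- After routine bookkeeping for lower and
-- upper bounds of small sets (valid for any relation) and the calculus of
-- the complementation, the pseudo-orthomodular law is used in two forms:
--   * direct:  t ≤ y and t below every upper bound of L(x,y) ∪ {y'} give t ≤ x;
--   * dual:    w ≥ y' and w above every element of L(U(x,y'),y) give x ≤ w.
-- The direct form yields the key property of R:  R(x,y) ∩ L(x) ⊆ L(y).
-- Axioms (1)-(4) then follow from these facts, and the divisibility criterion
-- follows because M(R(x,y),x) is literally the union on the left-hand side,
-- while L(U(R(x,y),x'),x) = L(x,y).

module Submission where

open import Defs
open import Level using (lift)
open import Data.Product using (_×_; _,_; proj₁; proj₂)
open import Data.Sum using (inj₁; inj₂)
open import Data.Unit using (tt)
open import Relation.Unary using (Pred; _⊆_; _∪_)
open import Relation.Unary.Properties using (≐-sym; ≐-trans)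
open import Relation.Binary.PropositionalEquality using (_≡_; refl; subst; sym)
open import Relation.Binary.Structures using (IsPartialOrder)
open import Function.Bundles using (_⇔_; mk⇔)

module Bounds {a} {C : Set a} (_≤_ : C → C → Set a) where
  open PosetOps _≤_

  lo-sg : ∀ {t u} → t ≤ u → Lo (sg u) t
  lo-sg t≤u _ refl = t≤u

  lo-sg⁻ : ∀ {t u} → Lo (sg u) t → t ≤ u
  lo-sg⁻ h = h _ refl

  lo-pr : ∀ {t u v} → t ≤ u → t ≤ v → Lo (pr u v) t
  lo-pr t≤u t≤v _ (inj₁ refl) = t≤u
  lo-pr t≤u t≤v _ (inj₂ refl) = t≤v

  lo-pr₁ : ∀ {t u v} → Lo (pr u v) t → t ≤ u
  lo-pr₁ h = h _ (inj₁ refl)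

  lo-pr₂ : ∀ {t u v} → Lo (pr u v) t → t ≤ v
  lo-pr₂ h = h _ (inj₂ refl)

  lo-pr-swap : ∀ {t u v} → Lo (pr u v) t → Lo (pr v u) t
  lo-pr-swap h = lo-pr (lo-pr₂ h) (lo-pr₁ h)

  up-pr : ∀ {t u v} → u ≤ t → v ≤ t → Up (pr u v) t
  up-pr u≤t v≤t _ (inj₁ refl) = u≤t
  up-pr u≤t v≤t _ (inj₂ refl) = v≤t

  up-pr₁ : ∀ {t u v} → Up (pr u v) t → u ≤ t
  up-pr₁ h = h _ (inj₁ refl)

  up-pr₂ : ∀ {t u v} → Up (pr u v) t → v ≤ t
  up-pr₂ h = h _ (inj₂ refl)

  lo-∪ : ∀ {A : Pred C a} {t b} → Lo A t → t ≤ b → Lo (A ∪ sg b) t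
  lo-∪ hA t≤b w (inj₁ w∈A) = hA w w∈A
  lo-∪ hA t≤b w (inj₂ refl) = t≤b

  lo-∪₁ : ∀ {A : Pred C a} {t b} → Lo (A ∪ sg b) t → Lo A t
  lo-∪₁ h w w∈A = h w (inj₁ w∈A)

  lo-∪₂ : ∀ {A : Pred C a} {t b} → Lo (A ∪ sg b) t → t ≤ b
  lo-∪₂ h = h _ (inj₂ refl)

  up-∪ : ∀ {A : Pred C a} {t b} → Up A t → b ≤ t → Up (A ∪ sg b) t
  up-∪ hA b≤t w (inj₁ w∈A) = hA w w∈A
  up-∪ hA b≤t w (inj₂ refl) = b≤t

  up-∪₁ : ∀ {A : Pred C a} {t b} → Up (A ∪ sg b) t → Up A t
  up-∪₁ h w w∈A = h w (inj₁ w∈A)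

  up-∪₂ : ∀ {A : Pred C a} {t b} → Up (A ∪ sg b) t → b ≤ t
  up-∪₂ h = h _ (inj₂ refl)

module Complementation {a} (P : BoundedPosetWithOp a) (comp : IsComplementation P) where
  open BoundedPosetWithOp P

  ′-antitone : ∀ {x y} → x ≤ y → (y ′) ≤ (x ′)
  ′-antitone = proj₁ (proj₂ (proj₂ comp)) _ _

  ′-involutive : ∀ x → ((x ′) ′) ≡ x
  ′-involutive = proj₂ (proj₂ (proj₂ comp))

  ′-swap : ∀ {x y} → (x ′) ≤ y → (y ′) ≤ x
  ′-swap {x} {y} x′≤y = subst (λ z → (y ′) ≤ z) (′-involutive x) (′-antitone x′≤y)

  ′-reflect : ∀ {x y} → (x ′) ≤ (y ′) → y ≤ x
  ′-reflect {x} {y} x′≤y′ =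
    subst (λ z → z ≤ x) (′-involutive y) (′-swap x′≤y′)

  complement-upper-bound : ∀ {x w} → x ≤ w → (x ′) ≤ w → w ≡ 𝟙
  complement-upper-bound {x} x≤w x′≤w = proj₁ (proj₁ (proj₂ comp) x) (up-pr x≤w x′≤w)
    where open Bounds _≤_

module PseudoOrthomodular {a} (P : BoundedPosetWithOp a) (pom : IsPseudoOrthomodular P) where
  open BoundedPosetWithOp P
  open Bounds _≤_
  open Complementation P (proj₁ pom)
  open IsPartialOrder isPartialOrder using () renaming (refl to ≤-refl; trans to ≤-trans)

  pom-law : ∀ {x y t} → t ≤ y → Lo (Up (Lo (pr x y) ∪ sg (y ′))) t → t ≤ x
  pom-law {x} {y} t≤y below = lo-pr₁ (proj₁ (proj₂ pom x y) (lo-∪ below t≤y))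

  -- Dual law, obtained by complementing:  U(L(U(x,y'),y),y') ⊆ U(x).
  pom-law-dual : ∀ {x y w} → (y ′) ≤ w → Up (Lo (Up (pr x (y ′)) ∪ sg y)) w → x ≤ w
  pom-law-dual {x} {y} {w} y′≤w above = ′-reflect (pom-law (′-swap y′≤w) w′-below)
    where
    -- every upper bound v of L(x',y) ∪ {y'} has v' ∈ L(U(x,y'),y), hence v' ≤ w
    w′-below : Lo (Up (Lo (pr (x ′) y) ∪ sg (y ′))) (w ′)
    w′-below v hv = ′-swap (above (v ′) (lo-∪ v′-below-upper (′-swap (up-∪₂ hv))))
      where
      v′-below-upper : Lo (Up (pr x (y ′))) (v ′)
      v′-below-upper s hs =
        ′-swap (up-∪₁ hv (s ′) (lo-pr (′-antitone (up-pr₁ hs)) (′-swap (up-pr₂ hs))))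

  R-below : ∀ {x y t} → R₅ P x y t → t ≤ x → t ≤ y
  R-below r t≤x = pom-law t≤x (λ w hw → r w (up-∪ (λ s hs → up-∪₁ hw s (lo-pr-swap hs)) (up-∪₂ hw)))

  lower-bounds-in-R : ∀ {x y t} → Lo (pr x y) t → R₅ P x y t
  lower-bounds-in-R t∈Lxy w hw = up-∪₁ hw _ t∈Lxy

  M-unit : ∀ x → (M₅ P x 𝟙 ≐ Lo (sg x)) × (M₅ P 𝟙 x ≐ Lo (sg x))
  M-unit x = (M-right , M-right⁻) , (M-left , M-left⁻)
    where
    -- x is an upper bound of {x, 1'}, since 1' ≤ x'' = x
    M-right : M₅ P x 𝟙 ⊆ Lo (sg x)
    M-right h = lo-sg (lo-∪₁ h x (up-pr ≤-refl (′-swap (𝟙-greatest (x ′)))))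

    M-right⁻ : Lo (sg x) ⊆ M₅ P x 𝟙
    M-right⁻ {t} h = lo-∪ (λ w hw → ≤-trans (lo-sg⁻ h) (up-pr₁ hw)) (𝟙-greatest t)

    M-left : M₅ P 𝟙 x ⊆ Lo (sg x)
    M-left h = lo-sg (lo-∪₂ h)

    M-left⁻ : Lo (sg x) ⊆ M₅ P 𝟙 x
    M-left⁻ {t} h = lo-∪ (λ w hw → ≤-trans (𝟙-greatest t) (up-pr₁ hw)) (lo-sg⁻ h)

  R-full : ∀ x y → (R₅ P x y ≐ Full P) ⇔ (x ≤ y)
  R-full x y = mk⇔ (λ full → R-below (proj₂ full (lift tt)) ≤-refl) R-full⁻
    where
    -- every upper bound of L(x,y) ∪ {x'} = L(x) ∪ {x'} bounds x and x', so is 1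
    R-full⁻ : x ≤ y → R₅ P x y ≐ Full P
    R-full⁻ x≤y = (λ _ → lift tt) , λ {t} _ w hw →
      subst (t ≤_) (sym (complement-upper-bound (up-∪₁ hw x (lo-pr ≤-refl x≤y)) (up-∪₂ hw)))
            (𝟙-greatest t)

  adjunction : ∀ x y z → (M₅ P x y ⊆ Lo (sg z)) ⇔ (Lo (sg x) ⊆ R₅ P y z)
  adjunction x y z = mk⇔ to from
    where
    -- L(U(x,y'),y) ⊆ L(y,z), so each upper bound of L(y,z) ∪ {y'} lies above x
    to : M₅ P x y ⊆ Lo (sg z) → Lo (sg x) ⊆ R₅ P y z
    to M⊆Lz {t} t≤x w hw = ≤-trans (lo-sg⁻ t≤x) (pom-law-dual (up-∪₂ hw) above)
      where
      above : Up (Lo (Up (pr x (y ′)) ∪ sg y)) w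
      above s hs = up-∪₁ hw s (lo-pr (lo-∪₂ hs) (lo-sg⁻ (M⊆Lz hs)))

    -- an element t of M(x,y) lies in R(y,z) ∩ L(y), hence below z
    from : Lo (sg x) ⊆ R₅ P y z → M₅ P x y ⊆ Lo (sg z)
    from Lx⊆R {t} h = lo-sg (R-below t∈R (lo-∪₂ h))
      where
      t∈R : R₅ P y z t
      t∈R w hw = lo-∪₁ h w (up-pr (Lx⊆R (lo-sg ≤-refl) w hw) (up-∪₂ hw))

  R-zero : ∀ x → R₅ P x 𝟘 ≐ Lo (sg (x ′))
  R-zero x = (λ r → lo-sg (r (x ′) x′-bound)) , (λ h w hw → ≤-trans (lo-sg⁻ h) (up-∪₂ hw))
    where
    x′-bound : Up (Lo (pr x 𝟘) ∪ sg (x ′)) (x ′)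
    x′-bound = up-∪ (λ s hs → ≤-trans (lo-pr₂ hs) (𝟘-least (x ′))) ≤-refl

  operator-left-residuated : IsOperatorLeftResiduated P (M₅ P) (R₅ P)
  operator-left-residuated = M-unit , R-full , adjunction , R-zero

  closure-of-R : ∀ x y → Lo (Up (R₅ P x y ∪ sg (x ′)) ∪ sg x) ≐ Lo (pr x y)
  closure-of-R x y = (λ h → lo-pr (lo-∪₂ h) (R-below (t∈R h) (lo-∪₂ h))) , ⊇
    where
    -- upper bounds of L(x,y) ∪ {x'} are upper bounds of R(x,y) ∪ {x'}
    t∈R : ∀ {t} → Lo (Up (R₅ P x y ∪ sg (x ′)) ∪ sg x) t → R₅ P x y t
    t∈R h w hw = lo-∪₁ h w (up-∪ (λ r r∈R → r∈R w hw) (up-∪₂ hw))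

    ⊇ : Lo (pr x y) ⊆ Lo (Up (R₅ P x y ∪ sg (x ′)) ∪ sg x)
    ⊇ h = lo-∪ (λ w hw → up-∪₁ hw _ (lower-bounds-in-R h)) (lo-pr₁ h)

liftM-singleton : ∀ {a} (P : BoundedPosetWithOp a) → let open BoundedPosetWithOp P in
                  (M : Carrier → Carrier → Pred Carrier a) (A : Pred Carrier a) (x : Carrier)
                → liftM P M A (sg x) ≐ ⋃ A (λ z → M z x)
liftM-singleton P M A x = (λ { (z , _ , z∈A , refl , w∈M) → z , z∈A , w∈M })
                        , (λ { (z , z∈A , w∈M) → z , x , z∈A , refl , w∈M })

≐-family-cong : ∀ {a} {I C : Set a} {A A′ B B′ : I → I → Pred C a}
              → (∀ i j → A i j ≐ A′ i j) → (∀ i j → B i j ≐ B′ i j)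
              → (∀ i j → A i j ≐ B i j) ⇔ (∀ i j → A′ i j ≐ B′ i j)
≐-family-cong A≐A′ B≐B′ = mk⇔
  (λ A≐B i j → ≐-trans (≐-sym (A≐A′ i j)) (≐-trans (A≐B i j) (B≐B′ i j)))
  (λ A′≐B′ i j → ≐-trans (A≐A′ i j) (≐-trans (A′≐B′ i j) (≐-sym (B≐B′ i j))))

theorem5 : ∀ {a} (P : BoundedPosetWithOp a) → IsPseudoOrthomodular P
    → let open BoundedPosetWithOp P in
    IsOperatorLeftResiduated P (M₅ P) (R₅ P)
    × (Divisible P (M₅ P) (R₅ P)
    ⇔ (∀ x y → ⋃ (R₅ P x y) (λ z → Lo (Up (pr z (x ′)) ∪ sg x))
    ≐ Lo (Up (R₅ P x y ∪ sg (x ′)) ∪ sg x)))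
theorem5 P pom = operator-left-residuated , divisibility-criterion
  where
  open PseudoOrthomodular P pom
  open BoundedPosetWithOp P
  -- M(R(x,y),x) is the union on the left, and L(x,y) = L(U(R(x,y),x'),x)
  divisibility-criterion :
    Divisible P (M₅ P) (R₅ P)
    ⇔ (∀ x y → ⋃ (R₅ P x y) (λ z → Lo (Up (pr z (x ′)) ∪ sg x))
               ≐ Lo (Up (R₅ P x y ∪ sg (x ′)) ∪ sg x))
  divisibility-criterion =
    ≐-family-cong (λ x y → liftM-singleton P (M₅ P) (R₅ P x y) x)
                  (λ x y → ≐-sym (closure-of-R x y))
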